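{- Let $\varphi$ be a normal form $\mathrm{FO}^2[{\downarrow},{\downarrow_{+}},{\rightarrow},{\rightarrow^{+}}]$ formula, and let $\bar\alpha$ be a full type combined of two $\varphi$-consistent full types $\bar\alpha_1,\bar\alpha_2$. Then $\bar\alpha$ is $\varphi$-consistent.
   Context: Let $\tau_0$ be a finite set of unary symbols. Let $\Theta$ be the set of ten order formulas $\theta_{\downarrow}:=x{\downarrow}y$, $\theta_{\uparrow}:=y{\downarrow}x$, $\theta_{\downarrow\downarrow_+}:=x{\downarrow_{+}}y\wedge\neg x{\downarrow}y$, $\theta_{\uparrow\uparrow^+}:=y{\downarrow_{+}}x\wedge\neg y{\downarrow}x$, $\theta_{\rightarrow}:=x{\rightarrow}y$, $\theta_{\leftarrow}:=y{\rightarrow}x$, $\theta_{\rightrightarrows^+}:=x{\rightarrow^{+}}y\wedge\neg x{\rightarrow}y$, $\theta_{\leftleftarrows^+}:=y{\rightarrow^{+}}x\wedge\neg y{\rightarrow}x$, $\theta_{\not\sim}:=x\neq y\wedge\neg x{\downarrow_{+}}y\wedge\neg y{\downarrow_{+}}x\wedge\neg x{\rightarrow^{+}}y\wedge\neg y{\rightarrow^{+}}x$, $\theta_{=}:=x{=}y$ (here ${\downarrow}$ is the child relation, ${\rightarrow}$ the immediate right sibling relation, ${\downarrow_{+}},{\rightarrow^{+}}$ their transitive closures, in finite unranked trees). A 1-type is a subset of $\tau_0$, identified with the conjunction of corresponding unary literals. A full type is a function $\bar\alpha$ from $\Theta$ to sets of 1-types such that $\bar\alpha(\theta_{\uparrow}),\bar\alpha(\theta_{\rightarrow}),\bar\alpha(\theta_{\leftarrow})$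 have at most one element, $\bar\alpha(\theta_=)=\{\alpha\}$ is a singleton, and if $\bar\alpha(\theta_{\uparrow})$ (resp. $\bar\alpha(\theta_{\downarrow})$, $\bar\alpha(\theta_{\leftarrow})$, $\bar\alpha(\theta_{\rightarrow})$) is empty then so is $\bar\alpha(\theta_{\uparrow\uparrow^+})$ (resp. $\bar\alpha(\theta_{\downarrow\downarrow_+})$, $\bar\alpha(\theta_{\leftleftarrows^+})$, $\bar\alpha(\theta_{\rightrightarrows^+})$). $\bar\alpha$ is combined of $\bar\alpha_1,\bar\alpha_2$ if $\bar\alpha(\theta_=)=\bar\alpha_1(\theta_=)=\bar\alpha_2(\theta_=)$ and for each $\theta\in\Theta$, $\bar\alpha(\theta)=\bar\alpha_1(\theta)$ or $\bar\alpha(\theta)=\bar\alpha_2(\theta)$. A normal form formula is $\varphi=\forall xy\,\chi(x,y)\wedge\bigwedge_{i\in I}\forall x(\lambda_i(x)\Rightarrow\exists y(\eta_i(x,y)\wedge\psi_i(x,y)))$ with $\chi$ quantifier-free, $\lambda_i$ a unary atom, $\psi_i$ a boolean combination of unary atoms, $\eta_i\in\Theta$. A full type $\bar\alpha$ with $\bar\alpha(\theta_=)=\{\alpha\}$ is $\varphi$-consistent if for all $\theta\in\Theta$ and $\alpha'\in\bar\alpha(\theta)$, $\alpha(x)\wedge\alpha'(y)\wedge\theta(x,y)\models\chi(x,y)\wedge\chi(y,x)$, and for every conjunct $\forall x(\lambda_i(x)\Rightarrow\exists y(\eta_i\wedge\psi_i))$ with $\alpha(x)\models\lambda_i(x)$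 there is $\alpha'\in\bar\alpha(\eta_i)$ with $\alpha(x),\alpha'(y)\models\psi_i(x,y)$. -}

module Defs where

open import Level using (0ℓ)
open import Data.Nat using (ℕ; suc)
open import Data.Fin using (Fin; toℕ)
open import Data.Fin.Subset using (Subset; _∈_; _∉_)
open import Data.List using (List; length; lookup)
open import Data.List.Membership.Propositional renaming (_∈_ to _∈ₗ_)
open import Data.Product using (Σ; ∃; _×_; _,_)
open import Data.Sum using (_⊎_)
open import Data.Empty using (⊥)
open import Data.Unit using (⊤)
open import Relation.Nullary using (¬_)
open import Relation.Unary using (Pred; _≐_)
open import Relation.Binary.PropositionalEquality using (_≡_)
open import Relation.Binary.Construct.Closure.Transitive using (TransClosure)

-- The unary signature τ₀ is Fin k.  A 1-type is a subset of τ₀.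
OneType : ℕ → Set
OneType k = Subset k

-- Finite unranked trees whose nodes carry a 1-type (the set of unary
-- predicates true at the node), and their positions.

data Tree (k : ℕ) : Set where
  node : Subset k → List (Tree k) → Tree k

data Pos {k : ℕ} : Tree k → Set where
  root : ∀ {t} → Pos t
  sub  : ∀ {l ts} (i : Fin (length ts)) → Pos (lookup ts i) → Pos (node l ts)

label : ∀ {k} {t : Tree k} → Pos t → Subset k
label {t = node l ts} root = l
label (sub i p) = label p

data Child {k : ℕ} : {t : Tree k} → Pos t → Pos t → Set where
  c-root : ∀ {l ts} (i : Fin (length ts)) → Child {t = node l ts} root (sub i root)
  c-sub  : ∀ {l ts} (i : Fin (length ts)) {p q : Pos (lookup ts i)} →
           Child p q → Child {t = node l ts} (sub i p) (sub i q)

data Next {k : ℕ} : {t : Tree k} → Pos t → Pos t → Set where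
  n-root : ∀ {l ts} (i j : Fin (length ts)) → toℕ j ≡ suc (toℕ i) →
           Next {t = node l ts} (sub i root) (sub j root)
  n-sub  : ∀ {l ts} (i : Fin (length ts)) {p q : Pos (lookup ts i)} →
           Next p q → Next {t = node l ts} (sub i p) (sub i q)

Desc : ∀ {k} {t : Tree k} → Pos t → Pos t → Set
Desc = TransClosure Child

Foll : ∀ {k} {t : Tree k} → Pos t → Pos t → Set
Foll = TransClosure Next

data Var : Set where
  vx vy : Var

data BRel : Set where
  child desc next foll eq : BRel

data QF (k : ℕ) : Set where
  tt ff : QF k
  un   : Fin k → Var → QF k
  bin  : BRel → Var → Var → QF k
  ¬'_  : QF k → QF k
  _∧'_ : QF k → QF k → QF k
  _∨'_ : QF k → QF k → QF k

infixr 6 _∧'_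
infixr 5 _∨'_
infix 7 ¬'_

⟦_⟧ᵇ : ∀ {k} {t : Tree k} → BRel → Pos t → Pos t → Set
⟦ child ⟧ᵇ = Child
⟦ desc ⟧ᵇ = Desc
⟦ next ⟧ᵇ = Next
⟦ foll ⟧ᵇ = Foll
⟦ eq ⟧ᵇ = _≡_

⟦_⟧ : ∀ {k} → QF k → (t : Tree k) → (Var → Pos t) → Set
⟦ tt ⟧ t ρ = ⊤
⟦ ff ⟧ t ρ = ⊥
⟦ un a v ⟧ t ρ = a ∈ label (ρ v)
⟦ bin r v w ⟧ t ρ = ⟦ r ⟧ᵇ (ρ v) (ρ w)
⟦ ¬' φ ⟧ t ρ = ¬ ⟦ φ ⟧ t ρ
⟦ φ ∧' ψ ⟧ t ρ = ⟦ φ ⟧ t ρ × ⟦ ψ ⟧ t ρ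
⟦ φ ∨' ψ ⟧ t ρ = ⟦ φ ⟧ t ρ ⊎ ⟦ ψ ⟧ t ρ

env : ∀ {k} {t : Tree k} → Pos t → Pos t → Var → Pos t
env p q vx = p
env p q vy = q

data Θ : Set where
  θ↓ θ↑ θ↓↓₊ θ↑↑⁺ θ→ θ← θ⇉⁺ θ⇇⁺ θ≁ θ= : Θ

θ-formula : ∀ {k} → Θ → QF k
θ-formula θ↓   = bin child vx vy
θ-formula θ↑   = bin child vy vx
θ-formula θ↓↓₊ = bin desc vx vy ∧' ¬' bin child vx vy
θ-formula θ↑↑⁺ = bin desc vy vx ∧' ¬' bin child vy vx
θ-formula θ→   = bin next vx vy
θ-formula θ←   = bin next vy vx
θ-formula θ⇉⁺  = bin foll vx vy ∧' ¬' bin next vx vy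
θ-formula θ⇇⁺  = bin foll vy vx ∧' ¬' bin next vy vx
θ-formula θ≁   = ¬' bin eq vx vy ∧' ¬' bin desc vx vy ∧' ¬' bin desc vy vx
                 ∧' ¬' bin foll vx vy ∧' ¬' bin foll vy vx
θ-formula θ=   = bin eq vx vy

AtMostOne : ∀ {k} → Pred (OneType k) 0ℓ → Set
AtMostOne S = ∀ a b → S a → S b → a ≡ b

Empty : ∀ {k} → Pred (OneType k) 0ℓ → Set
Empty S = ∀ a → ¬ S a

record FullType (k : ℕ) : Set₁ where
  field
    F       : Θ → Pred (OneType k) 0ℓ
    α       : OneType k
    single  : F θ= ≐ (λ β → β ≡ α)
    one-↑   : AtMostOne (F θ↑)
    one-→   : AtMostOne (F θ→)
    one-←   : AtMostOne (F θ←)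
    emp-↑   : Empty (F θ↑) → Empty (F θ↑↑⁺)
    emp-↓   : Empty (F θ↓) → Empty (F θ↓↓₊)
    emp-←   : Empty (F θ←) → Empty (F θ⇇⁺)
    emp-→   : Empty (F θ→) → Empty (F θ⇉⁺)

open FullType public

Combined : ∀ {k} → FullType k → FullType k → FullType k → Set
Combined a a₁ a₂ =
  (F a θ= ≐ F a₁ θ=) × (F a₁ θ= ≐ F a₂ θ=) ×
  (∀ θ → (F a θ ≐ F a₁ θ) ⊎ (F a θ ≐ F a₂ θ))

data UF (k : ℕ) : Set where
  tt ff : UF k
  un   : Fin k → Var → UF k
  ¬'_  : UF k → UF k
  _∧'_ : UF k → UF k → UF k
  _∨'_ : UF k → UF k → UF k

⟦_⟧ᵘ : ∀ {k} → UF k → OneType k → OneType k → Set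
⟦ tt ⟧ᵘ α α' = ⊤
⟦ ff ⟧ᵘ α α' = ⊥
⟦ un a vx ⟧ᵘ α α' = a ∈ α
⟦ un a vy ⟧ᵘ α α' = a ∈ α'
⟦ ¬' ψ ⟧ᵘ α α' = ¬ ⟦ ψ ⟧ᵘ α α'
⟦ ψ ∧' ψ' ⟧ᵘ α α' = ⟦ ψ ⟧ᵘ α α' × ⟦ ψ' ⟧ᵘ α α'
⟦ ψ ∨' ψ' ⟧ᵘ α α' = ⟦ ψ ⟧ᵘ α α' ⊎ ⟦ ψ' ⟧ᵘ α α'

-- ∀x (λ(x) ⇒ ∃y (η(x,y) ∧ ψ(x,y)))   with λ the unary atom given by `lam`
record Conjunct (k : ℕ) : Set where
  field
    lam : Fin k
    η   : Θ
    ψ   : UF k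

-- ∀xy χ(x,y) ∧ ⋀_{i∈I} (conjuncts)
record NormalForm (k : ℕ) : Set where
  field
    χ         : QF k
    conjuncts : List (Conjunct k)

Entails : ∀ {k} → OneType k → OneType k → Θ → QF k → Set
Entails α α' θ χ =
  ∀ (t : Tree _) (p q : Pos t) → label p ≡ α → label q ≡ α' →
  ⟦ θ-formula θ ⟧ t (env p q) → ⟦ χ ⟧ t (env p q) × ⟦ χ ⟧ t (env q p)

Consistent : ∀ {k} → NormalForm k → FullType k → Set
Consistent φ a =
  (∀ θ α' → F a θ α' → Entails (α a) α' θ (NormalForm.χ φ)) ×
  (∀ c → c ∈ₗ NormalForm.conjuncts φ → Conjunct.lam c ∈ α a →
     ∃ λ α' → F a (Conjunct.η c) α' × ⟦ Conjunct.ψ c ⟧ᵘ (α a) α')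

module Submission where

-- Proof idea.  φ-consistency of a full type ā is a conjunction of local
-- conditions, each of which mentions the central 1-type α of ā together
-- with the single set ā(θ) for one order formula θ:
--   * the χ-condition for θ needs every α' ∈ ā(θ) to entail χ, so it passes
--     from b̄ to ā when ā(θ) ⊆ b̄(θ);
--   * the witness condition for a conjunct with order formula η needs some
--     α' ∈ ā(η), so it passes from b̄ to ā when b̄(η) ⊆ ā(η).
-- In both cases ā and b̄ must have the same central type, which follows
-- from ā(θ=) = b̄(θ=) since that set is the singleton of the central type.
-- A combined type agrees, at every θ, with ā₁(θ) or with ā₂(θ), and has
-- the same central type as both; so each local condition is inherited from
-- whichever of ā₁, ā₂ it agrees with at that θ.

open import Data.Nat using (ℕ)
open import Data.Product using (∃; _×_; _,_; proj₁; proj₂)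
open import Data.Sum using (inj₁; inj₂)
open import Data.Fin.Subset using (_∈_)
open import Data.List.Membership.Propositional renaming (_∈_ to _∈ₗ_)
open import Relation.Unary using () renaming (_⊆′_ to _⊆'_)
open import Relation.Binary.PropositionalEquality using (_≡_; refl)
open import Defs

-- The central 1-type is determined by ā(θ=): if ā(θ=) ⊆ b̄(θ=) then the
-- unique element α of ā(θ=) is also the unique element of b̄(θ=).
centre-unique : ∀ {k} (a b : FullType k) → F a θ= ⊆' F b θ= → α a ≡ α b
centre-unique a b a⊆b = proj₁ (single b) (a⊆b _ (proj₂ (single a) refl))

UniversalAt : ∀ {k} → NormalForm k → FullType k → Θ → Set
UniversalAt φ a θ = ∀ α' → F a θ α' → Entails (α a) α' θ (NormalForm.χ φ)

WitnessFor : ∀ {k} → FullType k → Conjunct k → Set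
WitnessFor a c = Conjunct.lam c ∈ α a →
  ∃ λ α' → F a (Conjunct.η c) α' × ⟦ Conjunct.ψ c ⟧ᵘ (α a) α'

universal-transfer : ∀ {k} (φ : NormalForm k) (a b : FullType k) (θ : Θ) →
  α a ≡ α b → F a θ ⊆' F b θ → UniversalAt φ b θ → UniversalAt φ a θ
universal-transfer φ a b θ refl a⊆b univ α' α'∈a = univ α' (a⊆b α' α'∈a)

witness-transfer : ∀ {k} (a b : FullType k) (c : Conjunct k) →
  α a ≡ α b → F b (Conjunct.η c) ⊆' F a (Conjunct.η c) → WitnessFor b c → WitnessFor a c
witness-transfer a b c refl b⊆a wit λ∈α with wit λ∈α
... | α' , α'∈b , ψ-holds = α' , b⊆a α' α'∈b , ψ-holds

proposition2 : ∀ {k : ℕ} (φ : NormalForm k) (a a₁ a₂ : FullType k) →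
    Combined a a₁ a₂ → Consistent φ a₁ → Consistent φ a₂ → Consistent φ a
proposition2 φ a a₁ a₂ (a=a₁ , a₁=a₂ , agrees) (univ₁ , wit₁) (univ₂ , wit₂) =
  universal , witness
  where
  centre₁ : α a ≡ α a₁
  centre₁ = centre-unique a a₁ (λ _ → proj₁ a=a₁)

  centre₂ : α a ≡ α a₂
  centre₂ = centre-unique a a₂ (λ _ z → proj₁ a₁=a₂ (proj₁ a=a₁ z))

  universal : ∀ θ → UniversalAt φ a θ
  universal θ with agrees θ
  ... | inj₁ (a⊆a₁ , _) = universal-transfer φ a a₁ θ centre₁ (λ _ → a⊆a₁) (univ₁ θ)
  ... | inj₂ (a⊆a₂ , _) = universal-transfer φ a a₂ θ centre₂ (λ _ → a⊆a₂) (univ₂ θ)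

  witness : ∀ c → c ∈ₗ NormalForm.conjuncts φ → WitnessFor a c
  witness c c∈φ with agrees (Conjunct.η c)
  ... | inj₁ (_ , a₁⊆a) = witness-transfer a a₁ c centre₁ (λ _ → a₁⊆a) (wit₁ c c∈φ)
  ... | inj₂ (_ , a₂⊆a) = witness-transfer a a₂ c centre₂ (λ _ → a₂⊆a) (wit₂ c c∈φ)
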